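{- Let $k\ge1$, let $G=(V,E)$ be a finite $(k+1)$-claw free graph with positive vertex weights $w$, let $O$ be a maximum-weight independent set and $A$ an independent set of $G$ with $N(o,A)\neq\emptyset$ for all $o\in O$. Suppose $A$ is locally optimal with respect to 1-exchanges. Then $$2w(O)\le w(A)+\sum_{o\in O}w(N(o,A))-\sum_{a\in A}\left[\frac{\Delta_a}{w_a}+\frac{\Psi_a}{w_a}\right].$$
   Context: $(k+1)$-claw free: no induced subgraph consisting of a vertex adjacent to $k+1$ pairwise non-adjacent vertices. $w(X)=\sum_{v\in X}w_v$, $w^2(X)=\sum_{v\in X}w_v^2$. For $X,Y\subseteq V$, $N(X,Y)=\{y\in Y: y\text{ adjacent to some }x\in X\}\cup(X\cap Y)$, $N(v,Y)=N(\{v\},Y)$, $A-a=A\setminus\{a\}$. For $o\in O$, $\pi(o)$ is a vertex of $N(o,A)$ of maximum weight (ties broken arbitrarily but consistently). For $a\in A$: $C_a=\{o\in O:\pi(o)=a\}$, $N^+_a=\{a\}\cup\bigcup_{o\in C_a}N(o,A-a)$, $\psi_{a,o}=(w_o-w_a)^2+w_a\,w(N(o,A-a))-w^2(N(o,A-a))$ for $o\in C_a$, $\Psi_a=\sum_{o\in C_a}\psi_{a,o}$, and $\Delta_a=w^2(N^+_a)-w^2(C_a)$. $A$ is locally optimal with respect to 1-exchanges if $w^2(C_a)\le w^2(N^+_a)$ for every $a\in A$.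
   Formalization: The vertex weights are positive rationals rather than positive reals. -}

module Defs where

open import Data.Nat using (ℕ; zero; suc)
open import Data.Fin using (Fin; zero; suc; _≟_)
open import Data.Bool using (Bool; true; false; _∧_; _∨_; not; if_then_else_)
open import Data.Rational using (ℚ; 0ℚ; _+_; _*_; _-_; _≤_; _<_; _÷_; >-nonZero)
open import Data.Product using (_×_)
open import Data.Empty using (⊥)
open import Relation.Nullary.Decidable using (⌊_⌋)
open import Relation.Binary.PropositionalEquality using (_≡_; _≢_)
open import Function.Definitions using (Injective)

VSet : ℕ → Set
VSet n = Fin n → Bool

sumℚ : ∀ {n} → (Fin n → ℚ) → ℚ
sumℚ {zero}  f = 0ℚ
sumℚ {suc n} f = f zero + sumℚ (λ i → f (suc i))

anyFin : ∀ {n} → (Fin n → Bool) → Bool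
anyFin {zero}  p = false
anyFin {suc n} p = p zero ∨ anyFin (λ i → p (suc i))

sumOver : ∀ {n} → VSet n → (Fin n → ℚ) → ℚ
sumOver X f = sumℚ (λ v → if X v then f v else 0ℚ)

record Graph (n : ℕ) : Set where
  field
    adj    : Fin n → Fin n → Bool
    sym    : ∀ u v → adj u v ≡ adj v u
    irrefl : ∀ v → adj v v ≡ false
open Graph public

ClawFree : ∀ {n} → ℕ → Graph n → Set
ClawFree {n} k G =
  ∀ (v : Fin n) (f : Fin (suc k) → Fin n) → Injective _≡_ _≡_ f →
  (∀ i → adj G v (f i) ≡ true) →
  (∀ i j → i ≢ j → adj G (f i) (f j) ≡ false) → ⊥

module _ {n : ℕ} (G : Graph n) where

  Independent : VSet n → Set
  Independent X = ∀ u v → X u ≡ true → X v ≡ true → adj G u v ≡ false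

  remove : VSet n → Fin n → VSet n
  remove A a v = A v ∧ not ⌊ v ≟ a ⌋

  Nbr : Fin n → VSet n → VSet n
  Nbr o Y y = Y y ∧ (adj G o y ∨ ⌊ o ≟ y ⌋)

  module _ (w : Fin n → ℚ) where

    wt : VSet n → ℚ
    wt X = sumOver X w

    wt² : VSet n → ℚ
    wt² X = sumOver X (λ v → w v * w v)

    MaxWeightIndependent : VSet n → Set
    MaxWeightIndependent O = Independent O × (∀ I → Independent I → wt I ≤ wt O)

    IsPi : VSet n → VSet n → (Fin n → Fin n) → Set
    IsPi O A π = ∀ o → O o ≡ true →
      (Nbr o A (π o) ≡ true) × (∀ a → Nbr o A a ≡ true → w a ≤ w (π o))

    module _ (O A : VSet n) (π : Fin n → Fin n) where

      C : Fin n → VSet n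
      C a o = O o ∧ ⌊ π o ≟ a ⌋

      Nplus : Fin n → VSet n
      Nplus a v = ⌊ v ≟ a ⌋ ∨ anyFin (λ o → C a o ∧ Nbr o (remove A a) v)

      ψ : Fin n → Fin n → ℚ
      ψ a o = ((w o - w a) * (w o - w a)) + w a * wt (Nbr o (remove A a))
              - wt² (Nbr o (remove A a))

      Ψ : Fin n → ℚ
      Ψ a = sumOver (C a) (ψ a)

      Δ : Fin n → ℚ
      Δ a = wt² (Nplus a) - wt² (C a)

      LocallyOptimal : Set
      LocallyOptimal = ∀ a → A a ≡ true → wt² (C a) ≤ wt² (Nplus a)

      penalty : (∀ v → 0ℚ < w v) → ℚ
      penalty pos = sumOver A (λ a →
        (Δ a ÷ w a) {{>-nonZero (pos a)}} + (Ψ a ÷ w a) {{>-nonZero (pos a)}})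

{-# OPTIONS --safe #-}
module Submission where

-- Fix a ∈ A and write c = w_a. For o ∈ C_a we have a ∈ N(o,A), so
-- w(N(o,A)) = c + w(N(o,A-a)), and expanding the square turns ψ_{a,o} into
--   w_o² − w²(N(o,A-a)) + c (w(N(o,A)) − 2 w_o).
-- Since N⁺_a is the union of {a} and the N(o,A-a), o ∈ C_a, the union bound gives
--   w²(N⁺_a) ≤ c² + Σ_{o∈C_a} w²(N(o,A-a)),
-- hence Δ_a + Ψ_a ≤ c (c + Σ_{o∈C_a} (w(N(o,A)) − 2 w_o)). Divide by c > 0 and sum
-- over a ∈ A: the sets C_a partition O, so the right-hand sides add up to
-- w(A) + Σ_{o∈O} w(N(o,A)) − 2 w(O). Only π(o) ∈ N(o,A) and positivity of w are
-- used.

open import Algebra.Bundles using (Ring)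
open import Data.Bool using (Bool; true; false; _∧_; _∨_; not; if_then_else_)
open import Data.Bool.Properties using (∧-identityʳ; ∧-comm)
open import Data.Fin using (Fin; zero; suc; _≟_)
open import Data.Fin.Properties using (suc-injective)
open import Data.Nat using (ℕ; zero; suc; _≥_)
open import Data.Product using (∃; proj₁)
open import Data.Rational
  using (ℚ; 0ℚ; 1ℚ; _+_; _*_; _-_; -_; _≤_; _<_; _÷_; 1/_; NonZero; >-nonZero; positive; nonNegative)
open import Data.Rational.Properties hiding (_≟_)
open import Data.Rational.Solver using (module +-*-Solver)
open import Function using (_∘_)
open import Relation.Binary.PropositionalEquality
open import Relation.Nullary using (yes; no)
open import Relation.Nullary.Decidable using (⌊_⌋; isYes≗does; dec-true; dec-false)

open import Defs hiding (sym)

open import Algebra.Properties.Semiring.Sum (Ring.semiring +-*-ring)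
  using (sum; sum-cong-≗; sum-replicate-zero; ∑-distrib-+; ∑-comm; *-distribˡ-sum)
open +-*-Solver

sumℚ≡sum : ∀ {n} (f : Fin n → ℚ) → sumℚ f ≡ sum f
sumℚ≡sum {zero}  f = refl
sumℚ≡sum {suc n} f = cong (f zero +_) (sumℚ≡sum (f ∘ suc))

sumℚ-cong : ∀ {n} {f g : Fin n → ℚ} → (∀ i → f i ≡ g i) → sumℚ f ≡ sumℚ g
sumℚ-cong {f = f} {g} f≗g rewrite sumℚ≡sum f | sumℚ≡sum g = sum-cong-≗ f≗g

sumℚ-zero : ∀ {n} {f : Fin n → ℚ} → (∀ i → f i ≡ 0ℚ) → sumℚ f ≡ 0ℚ
sumℚ-zero {n} f≗0 =
  trans (sumℚ-cong f≗0) (trans (sumℚ≡sum {n} (λ _ → 0ℚ)) (sum-replicate-zero n))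

sumℚ-distrib-+ : ∀ {n} (f g : Fin n → ℚ) → sumℚ (λ i → f i + g i) ≡ sumℚ f + sumℚ g
sumℚ-distrib-+ f g
  rewrite sumℚ≡sum f | sumℚ≡sum g | sumℚ≡sum (λ i → f i + g i) = ∑-distrib-+ f g

*-distribˡ-sumℚ : ∀ {n} c (f : Fin n → ℚ) → c * sumℚ f ≡ sumℚ (λ i → c * f i)
*-distribˡ-sumℚ c f
  rewrite sumℚ≡sum f | sumℚ≡sum (λ i → c * f i) = *-distribˡ-sum c f

sumℚ-comm : ∀ {m n} (f : Fin m → Fin n → ℚ) →
            sumℚ (λ i → sumℚ (f i)) ≡ sumℚ (λ j → sumℚ (λ i → f i j))
sumℚ-comm f = begin
  sumℚ (λ i → sumℚ (f i))          ≡⟨ nested f ⟩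
  sum (λ i → sum (f i))            ≡⟨ ∑-comm f ⟩
  sum (λ j → sum (λ i → f i j))    ≡⟨ nested (λ j i → f i j) ⟨
  sumℚ (λ j → sumℚ (λ i → f i j))  ∎
  where
  open ≡-Reasoning
  nested : ∀ {m n} (g : Fin m → Fin n → ℚ) → sumℚ (λ i → sumℚ (g i)) ≡ sum (λ i → sum (g i))
  nested g = trans (sumℚ-cong (sumℚ≡sum ∘ g)) (sumℚ≡sum (λ i → sum (g i)))

sumℚ-distrib-− : ∀ {n} (f g : Fin n → ℚ) → sumℚ (λ i → f i - g i) ≡ sumℚ f - sumℚ g
sumℚ-distrib-− {zero}  f g = refl
sumℚ-distrib-− {suc n} f g =
  trans (cong (f zero - g zero +_) (sumℚ-distrib-− (f ∘ suc) (g ∘ suc)))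
        (solve 4 (λ a b c d → (a :- b) :+ (c :- d) := (a :+ c) :- (b :+ d)) refl
               (f zero) (g zero) (sumℚ (f ∘ suc)) (sumℚ (g ∘ suc)))

sumℚ-mono-≤ : ∀ {n} {f g : Fin n → ℚ} → (∀ i → f i ≤ g i) → sumℚ f ≤ sumℚ g
sumℚ-mono-≤ {zero}  f≤g = ≤-refl
sumℚ-mono-≤ {suc n} f≤g = +-mono-≤ (f≤g zero) (sumℚ-mono-≤ (f≤g ∘ suc))

sumℚ-single : ∀ {n} (f : Fin n → ℚ) (a : Fin n) → (∀ i → i ≢ a → f i ≡ 0ℚ) → sumℚ f ≡ f a
sumℚ-single f zero    f≗0 =
  trans (cong (f zero +_) (sumℚ-zero (λ i → f≗0 (suc i) λ ()))) (+-identityʳ (f zero))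
sumℚ-single f (suc a) f≗0 =
  trans (cong (_+ sumℚ (f ∘ suc)) (f≗0 zero λ ()))
        (trans (+-identityˡ _)
               (sumℚ-single (f ∘ suc) a (λ i i≢a → f≗0 (suc i) (i≢a ∘ suc-injective))))

⌊≟⌋-refl : ∀ {n} (a : Fin n) → ⌊ a ≟ a ⌋ ≡ true
⌊≟⌋-refl a = trans (isYes≗does (a ≟ a)) (dec-true (a ≟ a) refl)

⌊≟⌋-≢ : ∀ {n} {a b : Fin n} → a ≢ b → ⌊ a ≟ b ⌋ ≡ false
⌊≟⌋-≢ {a = a} {b} a≢b = trans (isYes≗does (a ≟ b)) (dec-false (a ≟ b) a≢b)

when : Bool → ℚ → ℚ
when b x = if b then x else 0ℚ

when-zero : ∀ b → when b 0ℚ ≡ 0ℚ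
when-zero true  = refl
when-zero false = refl

when-nonNeg : ∀ b {x} → 0ℚ ≤ x → 0ℚ ≤ when b x
when-nonNeg true  x≥0 = x≥0
when-nonNeg false x≥0 = ≤-refl

when-mono-≤ : ∀ b {x y} → x ≤ y → when b x ≤ when b y
when-mono-≤ true  x≤y = x≤y
when-mono-≤ false x≤y = ≤-refl

when-distrib-+ : ∀ b x y → when b (x + y) ≡ when b x + when b y
when-distrib-+ true  x y = refl
when-distrib-+ false x y = refl

when-distrib-− : ∀ b x y → when b (x - y) ≡ when b x - when b y
when-distrib-− true  x y = refl
when-distrib-− false x y = refl

*-distribˡ-when : ∀ b c x → c * when b x ≡ when b (c * x)
*-distribˡ-when true  c x = refl
*-distribˡ-when false c x = *-zeroʳ c

when-sumℚ : ∀ {n} b (f : Fin n → ℚ) → when b (sumℚ f) ≡ sumℚ (λ i → when b (f i))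
when-sumℚ     true  f = refl
when-sumℚ {n} false f = sym (sumℚ-zero {n} {λ _ → 0ℚ} (λ _ → refl))

when-∨-≤ : ∀ b c {x} → 0ℚ ≤ x → when (b ∨ c) x ≤ when b x + when c x
when-∨-≤ true  c {x} x≥0 =
  ≤-trans (≤-reflexive (sym (+-identityʳ x))) (+-monoʳ-≤ x (when-nonNeg c x≥0))
when-∨-≤ false c     x≥0 = ≤-reflexive (sym (+-identityˡ _))

when-anyFin-≤ : ∀ {n} (p : Fin n → Bool) {x} → 0ℚ ≤ x →
                when (anyFin p) x ≤ sumℚ (λ i → when (p i) x)
when-anyFin-≤ {zero}  p x≥0 = ≤-refl
when-anyFin-≤ {suc n} p x≥0 =
  ≤-trans (when-∨-≤ (p zero) (anyFin (p ∘ suc)) x≥0)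
          (+-monoʳ-≤ (when (p zero) _) (when-anyFin-≤ (p ∘ suc) x≥0))

sumOver-cong : ∀ {n} (X : VSet n) {f g : Fin n → ℚ} →
               (∀ v → X v ≡ true → f v ≡ g v) → sumOver X f ≡ sumOver X g
sumOver-cong X {f} {g} f≗g = sumℚ-cong pointwise
  where
  pointwise : ∀ v → when (X v) (f v) ≡ when (X v) (g v)
  pointwise v with X v in Xv
  ... | true  = f≗g v Xv
  ... | false = refl

sumOver-congˡ : ∀ {n} {X Y : VSet n} (f : Fin n → ℚ) → (∀ v → X v ≡ Y v) →
                sumOver X f ≡ sumOver Y f
sumOver-congˡ f X≗Y = sumℚ-cong (λ v → cong (λ b → when b (f v)) (X≗Y v))

sumOver-mono-≤ : ∀ {n} (X : VSet n) {f g : Fin n → ℚ} → (∀ v → f v ≤ g v) →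
                 sumOver X f ≤ sumOver X g
sumOver-mono-≤ X f≤g = sumℚ-mono-≤ (λ v → when-mono-≤ (X v) (f≤g v))

sumOver-distrib-+ : ∀ {n} (X : VSet n) (f g : Fin n → ℚ) →
                    sumOver X (λ v → f v + g v) ≡ sumOver X f + sumOver X g
sumOver-distrib-+ X f g =
  trans (sumℚ-cong (λ v → when-distrib-+ (X v) (f v) (g v)))
        (sumℚ-distrib-+ (λ v → when (X v) (f v)) (λ v → when (X v) (g v)))

sumOver-distrib-− : ∀ {n} (X : VSet n) (f g : Fin n → ℚ) →
                    sumOver X (λ v → f v - g v) ≡ sumOver X f - sumOver X g
sumOver-distrib-− X f g =
  trans (sumℚ-cong (λ v → when-distrib-− (X v) (f v) (g v)))
        (sumℚ-distrib-− (λ v → when (X v) (f v)) (λ v → when (X v) (g v)))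

*-distribˡ-sumOver : ∀ {n} c (X : VSet n) (f : Fin n → ℚ) →
                     c * sumOver X f ≡ sumOver X (λ v → c * f v)
*-distribˡ-sumOver c X f =
  trans (*-distribˡ-sumℚ c (λ v → when (X v) (f v)))
        (sumℚ-cong (λ v → *-distribˡ-when (X v) c (f v)))

sumOver-∧ : ∀ {n} b (Y : VSet n) (f : Fin n → ℚ) →
            sumOver (λ v → b ∧ Y v) f ≡ when b (sumOver Y f)
sumOver-∧     true  Y f = refl
sumOver-∧ {n} false Y f = sumℚ-zero {n} {λ _ → 0ℚ} (λ _ → refl)

sumOver-singleton : ∀ {n} (a : Fin n) (f : Fin n → ℚ) → sumOver (λ v → ⌊ v ≟ a ⌋) f ≡ f a
sumOver-singleton a f = trans (sumℚ-single _ a off) on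
  where
  off : ∀ v → v ≢ a → when ⌊ v ≟ a ⌋ (f v) ≡ 0ℚ
  off v v≢a rewrite ⌊≟⌋-≢ v≢a = refl
  on : when ⌊ a ≟ a ⌋ (f a) ≡ f a
  on rewrite ⌊≟⌋-refl a = refl

sumOver-pick : ∀ {n} {X : VSet n} {a} (f : Fin n → ℚ) → X a ≡ true →
               sumOver X f ≡ f a + sumOver (λ v → X v ∧ not ⌊ v ≟ a ⌋) f
sumOver-pick {X = X} {a} f Xa = begin
  sumOver X f
    ≡⟨ sumℚ-cong split ⟩
  sumℚ (λ v → when ⌊ v ≟ a ⌋ (f v) + when (X-a v) (f v))
    ≡⟨ sumℚ-distrib-+ _ (λ v → when (X-a v) (f v)) ⟩
  sumOver (λ v → ⌊ v ≟ a ⌋) f + sumOver X-a f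
    ≡⟨ cong (_+ sumOver X-a f) (sumOver-singleton a f) ⟩
  f a + sumOver X-a f
    ∎
  where
  open ≡-Reasoning
  X-a : VSet _
  X-a v = X v ∧ not ⌊ v ≟ a ⌋
  split : ∀ v → when (X v) (f v) ≡ when ⌊ v ≟ a ⌋ (f v) + when (X-a v) (f v)
  split v with v ≟ a
  ... | yes refl rewrite Xa = sym (+-identityʳ (f a))
  ... | no _     rewrite ∧-identityʳ (X v) = sym (+-identityˡ _)

sumOver-∪-≤ : ∀ {m n} (X : VSet n) (Y : Fin m → VSet n) {f : Fin n → ℚ} → (∀ v → 0ℚ ≤ f v) →
              sumOver (λ v → X v ∨ anyFin (λ o → Y o v)) f
                ≤ sumOver X f + sumℚ (λ o → sumOver (Y o) f)
sumOver-∪-≤ X Y {f} f≥0 = begin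
  sumOver (λ v → X v ∨ anyFin (λ o → Y o v)) f
    ≤⟨ sumℚ-mono-≤ (λ v → ≤-trans (when-∨-≤ (X v) _ (f≥0 v))
                                   (+-monoʳ-≤ (when (X v) (f v))
                                              (when-anyFin-≤ (λ o → Y o v) (f≥0 v)))) ⟩
  sumℚ (λ v → when (X v) (f v) + sumℚ (λ o → when (Y o v) (f v)))
    ≡⟨ sumℚ-distrib-+ (λ v → when (X v) (f v)) (λ v → sumℚ (λ o → when (Y o v) (f v))) ⟩
  sumOver X f + sumℚ (λ v → sumℚ (λ o → when (Y o v) (f v)))
    ≡⟨ cong (sumOver X f +_) (sumℚ-comm (λ v o → when (Y o v) (f v))) ⟩
  sumOver X f + sumℚ (λ o → sumOver (Y o) f)
    ∎
  where open ≤-Reasoning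

sumOver-fibres : ∀ {m n} (X : VSet m) (Y : VSet n) (π : Fin n → Fin m) (h : Fin n → ℚ) →
                 (∀ o → Y o ≡ true → X (π o) ≡ true) →
                 sumOver X (λ a → sumOver (λ o → Y o ∧ ⌊ π o ≟ a ⌋) h) ≡ sumOver Y h
sumOver-fibres X Y π h πY⊆X = begin
  sumℚ (λ a → when (X a) (sumℚ (λ o → when (Y o ∧ ⌊ π o ≟ a ⌋) (h o))))
    ≡⟨ sumℚ-cong (λ a → when-sumℚ (X a) (λ o → when (Y o ∧ ⌊ π o ≟ a ⌋) (h o))) ⟩
  sumℚ (λ a → sumℚ (λ o → term o a))  ≡⟨ sumℚ-comm (λ a o → term o a) ⟩
  sumℚ (λ o → sumℚ (term o))          ≡⟨ sumℚ-cong fibre ⟩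
  sumOver Y h                         ∎
  where
  open ≡-Reasoning
  term : _ → _ → ℚ
  term o a = when (X a) (when (Y o ∧ ⌊ π o ≟ a ⌋) (h o))
  fibre : ∀ o → sumℚ (term o) ≡ when (Y o) (h o)
  fibre o with Y o in Yo
  ... | false = sumℚ-zero (λ a → when-zero (X a))
  ... | true  = trans (sumℚ-single _ (π o) off) on
    where
    off : ∀ a → a ≢ π o → when (X a) (when ⌊ π o ≟ a ⌋ (h o)) ≡ 0ℚ
    off a a≢πo rewrite ⌊≟⌋-≢ (a≢πo ∘ sym) = when-zero (X a)
    on : when (X (π o)) (when ⌊ π o ≟ π o ⌋ (h o)) ≡ h o
    on rewrite πY⊆X o Yo | ⌊≟⌋-refl (π o) = refl

square-nonNeg : ∀ {x} → 0ℚ < x → 0ℚ ≤ x * x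
square-nonNeg {x} x>0 =
  ≤-trans (≤-reflexive (sym (*-zeroʳ x))) (*-monoˡ-≤-nonNeg x {{nonNegative (<⇒≤ x>0)}} (<⇒≤ x>0))

÷-distrib-+ : ∀ x y c .{{_ : NonZero c}} → x ÷ c + y ÷ c ≡ (x + y) ÷ c
÷-distrib-+ x y c = sym (*-distribʳ-+ (1/ c) x y)

÷-≤ : ∀ {x r c} (c>0 : 0ℚ < c) → x ≤ c * r → (x ÷ c) {{>-nonZero c>0}} ≤ r
÷-≤ {x} {r} {c} c>0 x≤cr = *-cancelʳ-≤-pos c {{positive c>0}} (begin
  x * 1/ c * c    ≡⟨ *-assoc x (1/ c) c ⟩
  x * (1/ c * c)  ≡⟨ cong (x *_) (*-inverseˡ c) ⟩
  x * 1ℚ          ≡⟨ *-identityʳ x ⟩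
  x               ≤⟨ x≤cr ⟩
  c * r           ≡⟨ *-comm c r ⟩
  r * c           ∎)
  where
  instance _ = >-nonZero c>0
  open ≤-Reasoning

module _ {n} (G : Graph n) where

  Nbr-⊆ : ∀ {o} {A : VSet n} {v} → Nbr G o A v ≡ true → A v ≡ true
  Nbr-⊆ {A = A} {v} o~v with A v
  ... | true = refl

  sumOver-Nbr-remove : ∀ {o a} {A : VSet n} (f : Fin n → ℚ) → Nbr G o A a ≡ true →
                       sumOver (Nbr G o A) f ≡ f a + sumOver (Nbr G o (remove G A a)) f
  sumOver-Nbr-remove {o} {a} {A} f o~a =
    trans (sumOver-pick f o~a) (cong (f a +_) (sumOver-congˡ f reorder))
    where
    reorder : ∀ v → Nbr G o A v ∧ not ⌊ v ≟ a ⌋ ≡ Nbr G o (remove G A a) v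
    reorder v with A v
    ... | true  = ∧-comm (adj G o v ∨ ⌊ o ≟ v ⌋) (not ⌊ v ≟ a ⌋)
    ... | false = refl

module Charging {n} (G : Graph n) (w : Fin n → ℚ) (pos : ∀ v → 0ℚ < w v) (O A : VSet n)
                (π : Fin n → Fin n) (π∈N : ∀ o → O o ≡ true → Nbr G o A (π o) ≡ true) where

  private
    Cₐ : Fin n → VSet n
    Cₐ = C G w O A π

    N⁻ : Fin n → Fin n → VSet n
    N⁻ a o = Nbr G o (remove G A a)

    sq : Fin n → ℚ
    sq v = w v * w v

  excess : Fin n → ℚ
  excess o = wt G w (Nbr G o A) - (w o + w o)

  budget : Fin n → ℚ
  budget a = w a + sumOver (Cₐ a) excess

  C⊆N : ∀ {a o} → Cₐ a o ≡ true → Nbr G o A a ≡ true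
  C⊆N {a} {o} o∈Cₐ with O o in Oo | π o ≟ a
  ... | true | yes refl = π∈N o Oo

  ψ-split : ∀ {a o} → Cₐ a o ≡ true →
            ψ G w O A π a o ≡ (sq o - wt² G w (N⁻ a o)) + w a * excess o
  ψ-split {a} {o} o∈Cₐ = begin
    ((w o - w a) * (w o - w a) + w a * wt G w (N⁻ a o)) - wt² G w (N⁻ a o)
      ≡⟨ solve 4 (λ x c s m → ((x :- c) :* (x :- c) :+ c :* s) :- m
                              := (x :* x :- m) :+ c :* ((c :+ s) :- (x :+ x)))
                 refl (w o) (w a) (wt G w (N⁻ a o)) (wt² G w (N⁻ a o)) ⟩
    (sq o - wt² G w (N⁻ a o)) + w a * ((w a + wt G w (N⁻ a o)) - (w o + w o))
      ≡⟨ cong (λ t → (sq o - wt² G w (N⁻ a o)) + w a * (t - (w o + w o)))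
              (sumOver-Nbr-remove G w (C⊆N o∈Cₐ)) ⟨
    (sq o - wt² G w (N⁻ a o)) + w a * excess o
      ∎
    where open ≡-Reasoning

  Ψ-split : ∀ a → Ψ G w O A π a ≡
            (wt² G w (Cₐ a) - sumOver (Cₐ a) (wt² G w ∘ N⁻ a)) + w a * sumOver (Cₐ a) excess
  Ψ-split a = begin
    sumOver (Cₐ a) (ψ G w O A π a)
      ≡⟨ sumOver-cong (Cₐ a) (λ o → ψ-split) ⟩
    sumOver (Cₐ a) (λ o → (sq o - wt² G w (N⁻ a o)) + w a * excess o)
      ≡⟨ sumOver-distrib-+ (Cₐ a) _ _ ⟩
    sumOver (Cₐ a) (λ o → sq o - wt² G w (N⁻ a o)) + sumOver (Cₐ a) (λ o → w a * excess o)
      ≡⟨ cong₂ _+_ (sumOver-distrib-− (Cₐ a) sq (wt² G w ∘ N⁻ a))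
                   (sym (*-distribˡ-sumOver (w a) (Cₐ a) excess)) ⟩
    (wt² G w (Cₐ a) - sumOver (Cₐ a) (wt² G w ∘ N⁻ a)) + w a * sumOver (Cₐ a) excess
      ∎
    where open ≡-Reasoning

  wt²-Nplus-≤ : ∀ a → wt² G w (Nplus G w O A π a) ≤ sq a + sumOver (Cₐ a) (wt² G w ∘ N⁻ a)
  wt²-Nplus-≤ a = begin
    wt² G w (Nplus G w O A π a)
      ≤⟨ sumOver-∪-≤ (λ v → ⌊ v ≟ a ⌋) (λ o v → Cₐ a o ∧ N⁻ a o v) (square-nonNeg ∘ pos) ⟩
    sumOver (λ v → ⌊ v ≟ a ⌋) sq + sumℚ (λ o → sumOver (λ v → Cₐ a o ∧ N⁻ a o v) sq)
      ≡⟨ cong₂ _+_ (sumOver-singleton a sq) (sumℚ-cong (λ o → sumOver-∧ (Cₐ a o) (N⁻ a o) sq)) ⟩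
    sq a + sumOver (Cₐ a) (wt² G w ∘ N⁻ a)
      ∎
    where open ≤-Reasoning

  Δ+Ψ-≤ : ∀ a → Δ G w O A π a + Ψ G w O A π a ≤ w a * budget a
  Δ+Ψ-≤ a = begin
    (T - Q) + Ψ G w O A π a    ≡⟨ cong ((T - Q) +_) (Ψ-split a) ⟩
    (T - Q) + ((Q - M) + c * H)
      ≡⟨ solve 5 (λ t q m c h → (t :- q) :+ ((q :- m) :+ c :* h) := (t :- m) :+ c :* h)
               refl T Q M c H ⟩
    (T - M) + c * H            ≤⟨ +-monoˡ-≤ (c * H) (+-monoˡ-≤ (- M) (wt²-Nplus-≤ a)) ⟩
    ((c * c + M) - M) + c * H
      ≡⟨ solve 3 (λ c m h → ((c :* c :+ m) :- m) :+ c :* h := c :* (c :+ h)) refl c M H ⟩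
    c * (c + H)                ∎
    where
    open ≤-Reasoning
    c = w a
    T = wt² G w (Nplus G w O A π a)
    Q = wt² G w (Cₐ a)
    M = sumOver (Cₐ a) (wt² G w ∘ N⁻ a)
    H = sumOver (Cₐ a) excess

  penalty-≤ : penalty G w O A π pos ≤ sumOver A budget
  penalty-≤ = sumOver-mono-≤ A λ a → begin
    (Δ G w O A π a ÷ w a) {{_}} + (Ψ G w O A π a ÷ w a) {{_}}
      ≡⟨ ÷-distrib-+ (Δ G w O A π a) (Ψ G w O A π a) (w a) {{>-nonZero (pos a)}} ⟩
    ((Δ G w O A π a + Ψ G w O A π a) ÷ w a) {{_}}
      ≤⟨ ÷-≤ (pos a) (Δ+Ψ-≤ a) ⟩
    budget a
      ∎
    where open ≤-Reasoning

  sumOver-budget : sumOver A budget ≡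
                   wt G w A + (sumOver O (λ o → wt G w (Nbr G o A)) - (wt G w O + wt G w O))
  sumOver-budget = begin
    sumOver A (λ a → w a + sumOver (Cₐ a) excess)
      ≡⟨ sumOver-distrib-+ A w _ ⟩
    wt G w A + sumOver A (λ a → sumOver (Cₐ a) excess)
      ≡⟨ cong (wt G w A +_) (sumOver-fibres A O π excess (λ o → Nbr-⊆ G {A = A} ∘ π∈N o)) ⟩
    wt G w A + sumOver O excess
      ≡⟨ cong (wt G w A +_) (trans (sumOver-distrib-− O _ w+w)
                                   (cong (_-_ S) (sumOver-distrib-+ O w w))) ⟩
    wt G w A + (S - (wt G w O + wt G w O))
      ∎
    where
    open ≡-Reasoning
    S = sumOver O (λ o → wt G w (Nbr G o A))
    w+w : Fin n → ℚ
    w+w o = w o + w o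

lemma1 : (k : ℕ) → k ≥ 1 → (n : ℕ) (G : Graph n) → ClawFree k G →
         (w : Fin n → ℚ) (pos : ∀ v → 0ℚ < w v) →
         (O A : VSet n) → MaxWeightIndependent G w O → Independent G A →
         (∀ o → O o ≡ true → ∃ λ a → Nbr G o A a ≡ true) →
         (π : Fin n → Fin n) → IsPi G w O A π →
         LocallyOptimal G w O A π →
         (1ℚ + 1ℚ) * wt G w O
           ≤ (wt G w A + sumOver O (λ o → wt G w (Nbr G o A)))
             - penalty G w O A π pos
lemma1 _ _ _ G _ w pos O A _ _ _ π isPi _ = begin
  (1ℚ + 1ℚ) * W[O]
    ≡⟨ solve 3 (λ a s o → (con 1ℚ :+ con 1ℚ) :* o := (a :+ s) :- (a :+ (s :- (o :+ o))))
             refl W[A] S W[O] ⟩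
  (W[A] + S) - (W[A] + (S - (W[O] + W[O])))  ≡⟨ cong (_-_ (W[A] + S)) sumOver-budget ⟨
  (W[A] + S) - sumOver A budget              ≤⟨ +-monoʳ-≤ (W[A] + S) (neg-antimono-≤ penalty-≤) ⟩
  (W[A] + S) - penalty G w O A π pos         ∎
  where
  open Charging G w pos O A π (λ o → proj₁ ∘ isPi o)
  open ≤-Reasoning
  W[O] = wt G w O
  W[A] = wt G w A
  S = sumOver O (λ o → wt G w (Nbr G o A))
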